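{- Let $\mathcal{S}\subseteq\{0,1\}^n$ be an affine subspace and $s$ a positive integer. If $\mathcal{S}$ admits an $s$-sparse basis, then $\Phi(\mathcal{S};s)\ge 1/2$. Conversely, if $\Phi(\mathcal{S};s)=0$, then $\mathcal{S}$ does not admit an $s$-sparse basis.
   Context: $\{0,1\}^n$ is viewed as a vector space over $\mathrm{GF}(2)$; $d(\cdot,\cdot)$ is Hamming distance. A linear subspace $\mathcal{S}$ admits an $s$-sparse basis if there exist linearly independent vectors $x^{(1)},\dots,x^{(D)}\in\mathcal{S}$ spanning $\mathcal{S}$ with $d(x^{(l)},0)\le s$ for all $l$. An affine subspace $\mathcal{S}$ admits an $s$-sparse basis if there is $x^{(0)}\in\mathcal{S}$ such that the linear subspace $\mathcal{S}-x^{(0)}$ admits an $s$-sparse basis. For $\mathcal{S}\subseteq\{0,1\}^n$, let $\mathcal{G}(\mathcal{S},\ell)$ be the graph on vertex set $\mathcal{S}$ with an edge between $x,x'$ iff $d(x,x')\le \ell$; the conductance is $\Phi(\mathcal{S};\ell) \equiv \min_{A\subseteq\mathcal{S}} \frac{\mathrm{cut}_{\mathcal{G}(\mathcal{S},\ell)}(A,\mathcal{S}\setminus A)}{\min(|A|,|\mathcal{S}\setminus A|)}$, where $\mathrm{cut}$ counts edges between $A$ and $\mathcal{S}\setminus A$. -}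

module Defs where

open import Data.Bool using (Bool; true; false; _∧_; _xor_; not; if_then_else_)
open import Data.Nat using (ℕ; zero; suc; _+_; _*_; _≤_; _<_; _⊓_; _≤ᵇ_)
open import Data.List using (List; []; _∷_; _++_; map; concatMap)
open import Data.Nat.ListAction using (sum)
open import Data.Vec using (Vec; []; _∷_; zipWith; replicate; lookup; foldr)
open import Data.Fin using (Fin)
open import Data.Product using (Σ; _×_; ∃)
open import Relation.Binary.PropositionalEquality using (_≡_)

BVec : ℕ → Set
BVec n = Vec Bool n

_⊕_ : ∀ {n} → BVec n → BVec n → BVec n
_⊕_ = zipWith _xor_

0ᵥ : ∀ {n} → BVec n
0ᵥ {n} = replicate n false

weight : ∀ {n} → BVec n → ℕ
weight [] = 0
weight (true ∷ xs) = suc (weight xs)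
weight (false ∷ xs) = weight xs

dist : ∀ {n} → BVec n → BVec n → ℕ
dist x y = weight (x ⊕ y)

allVecs : (n : ℕ) → List (BVec n)
allVecs zero = [] ∷ []
allVecs (suc n) = map (false ∷_) (allVecs n) ++ map (true ∷_) (allVecs n)

Subset : ℕ → Set
Subset n = BVec n → Bool

_∈_ : ∀ {n} → BVec n → Subset n → Set
x ∈ S = S x ≡ true

_⊆_ : ∀ {n} → Subset n → Subset n → Set
A ⊆ B = ∀ x → x ∈ A → x ∈ B

card : ∀ {n} → Subset n → ℕ
card {n} A = sum (map (λ x → if A x then 1 else 0) (allVecs n))

_∖_ : ∀ {n} → Subset n → Subset n → Subset n
(S ∖ A) x = S x ∧ not (A x)

IsLinearSubspace : ∀ {n} → Subset n → Set
IsLinearSubspace S = (0ᵥ ∈ S) × (∀ x y → x ∈ S → y ∈ S → (x ⊕ y) ∈ S)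

-- S - x0 = { y : y + x0 ∈ S }  (over GF(2), minus = plus)
translate : ∀ {n} → Subset n → BVec n → Subset n
translate S x₀ y = S (y ⊕ x₀)

IsAffineSubspace : ∀ {n} → Subset n → Set
IsAffineSubspace {n} S = Σ (BVec n) λ x₀ → (x₀ ∈ S) × IsLinearSubspace (translate S x₀)

combo : ∀ {n D} → Vec (BVec n) D → Vec Bool D → BVec n
combo [] [] = 0ᵥ
combo (b ∷ bs) (true ∷ c) = b ⊕ combo bs c
combo (b ∷ bs) (false ∷ c) = combo bs c

LinearlyIndependent : ∀ {n D} → Vec (BVec n) D → Set
LinearlyIndependent {n} {D} bs = ∀ c → combo bs c ≡ 0ᵥ → c ≡ replicate D false

LinAdmitsSparseBasis : ∀ {n} → Subset n → ℕ → Set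
LinAdmitsSparseBasis {n} L s =
  Σ ℕ λ D → Σ (Vec (BVec n) D) λ bs →
    (∀ (i : Fin D) → lookup bs i ∈ L) ×
    (∀ (i : Fin D) → weight (lookup bs i) ≤ s) ×
    LinearlyIndependent bs ×
    (∀ y → y ∈ L → Σ (Vec Bool D) λ c → combo bs c ≡ y)

AdmitsSparseBasis : ∀ {n} → Subset n → ℕ → Set
AdmitsSparseBasis {n} S s =
  Σ (BVec n) λ x₀ → (x₀ ∈ S) × LinAdmitsSparseBasis (translate S x₀) s

cut : ∀ {n} → Subset n → ℕ → Subset n → ℕ
cut {n} S ℓ A =
  sum (concatMap (λ x → map (λ y →
        if A x ∧ (S ∖ A) y ∧ (dist x y ≤ᵇ ℓ) then 1 else 0) (allVecs n))
      (allVecs n))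

-- The subsets A over which the conductance minimum ranges (ratio defined):
-- A ⊆ S with A and S∖A both nonempty.
Admissible : ∀ {n} → Subset n → Subset n → Set
Admissible S A = (A ⊆ S) × (0 < card A) × (0 < card (S ∖ A))

-- Φ(S;ℓ) ≥ 1/2, unfolded: every admissible ratio cut/min(|A|,|S∖A|) is ≥ 1/2.
ConductanceAtLeastHalf : ∀ {n} → Subset n → ℕ → Set
ConductanceAtLeastHalf S ℓ =
  ∀ A → Admissible S A → card A ⊓ card (S ∖ A) ≤ 2 * cut S ℓ A

-- Φ(S;ℓ) = 0, unfolded: the (finite, attained) minimum is 0, i.e. some
-- admissible A has zero cut.
ConductanceZero : ∀ {n} → Subset n → ℕ → Set
ConductanceZero S ℓ = ∃ λ A → Admissible S A × (cut S ℓ A ≡ 0)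

module Submission where

-- If S = x₀ + span(b₁, …, b_D) with the bᵢ independent and of weight ≤ s, then
-- S is an "s-cube": a copy of the hypercube {0,1}^D in which the i-th coordinate
-- direction moves by bᵢ, so every hypercube edge joins points at distance ≤ s.
-- The proof therefore reduces the theorem to the edge-isoperimetric inequality
-- for the hypercube, min(|A|, |S ∖ A|) ≤ cut(A), proved by induction on D: write
-- the cube as T' ⊔ (T' + b), apply the hypothesis to A on both halves, and pay
-- for the mismatch between the two halves of A with the matching pairs (x, x ⊕ b).
-- This gives conductance ≥ 1, hence ≥ 1/2; a zero cut between two nonempty
-- sides then rules out a sparse basis.

open import Defs
open import Data.Bool using (Bool; true; false; _∧_; _∨_; not; if_then_else_)
open import Data.Bool.Properties
  using (xor-assoc; xor-comm; xor-identityˡ; xor-identityʳ; xor-same; ∧-assoc; ∧-identityʳ; ∨-zeroʳ; ∧-zeroʳ; T-≡; ⇔→≡)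
open import Function.Bundles using (Equivalence; mk⇔)
open import Data.Nat using (ℕ; zero; suc; _+_; _*_; _<_; _≤_; _⊓_; _≤ᵇ_; z≤n; s≤s)
open import Data.Nat.Properties
open import Algebra.Properties.CommutativeSemigroup +-commutativeSemigroup using (interchange; xy∙z≈xz∙y; xy∙z≈zx∙y)
open import Data.List using (List; []; _∷_; _++_; map; concatMap)
open import Data.List.Properties using (map-++; map-∘)
open import Data.Nat.ListAction using (sum)
open import Data.Nat.ListAction.Properties using (sum-++)
open import Data.Vec using (Vec; []; _∷_; lookup)
open import Data.Fin using (zero; suc)
open import Data.Vec.Properties
  using (∷-injectiveˡ; ∷-injectiveʳ; zipWith-assoc; zipWith-comm; zipWith-identityˡ; zipWith-identityʳ; zipWith-inverseˡ; map-id)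
open import Data.Product using (Σ; _×_; _,_; proj₂)
open import Data.Sum using (inj₁; inj₂)
open import Function using (id)
open import Relation.Binary.PropositionalEquality
open import Relation.Nullary using (¬_)

⊕-assoc : ∀ {n} (x y z : BVec n) → (x ⊕ y) ⊕ z ≡ x ⊕ (y ⊕ z)
⊕-assoc = zipWith-assoc xor-assoc

⊕-comm : ∀ {n} (x y : BVec n) → x ⊕ y ≡ y ⊕ x
⊕-comm = zipWith-comm xor-comm

⊕-identityˡ : ∀ {n} (x : BVec n) → 0ᵥ ⊕ x ≡ x
⊕-identityˡ = zipWith-identityˡ xor-identityˡ

⊕-identityʳ : ∀ {n} (x : BVec n) → x ⊕ 0ᵥ ≡ x
⊕-identityʳ = zipWith-identityʳ xor-identityʳ

⊕-self : ∀ {n} (x : BVec n) → x ⊕ x ≡ 0ᵥ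
⊕-self x = trans (cong (_⊕ x) (sym (map-id x))) (zipWith-inverseˡ {⁻¹ = id} xor-same x)

⊕-cancel : ∀ {n} (x b : BVec n) → (x ⊕ b) ⊕ b ≡ x
⊕-cancel x b = trans (⊕-assoc x b b) (trans (cong (x ⊕_) (⊕-self b)) (⊕-identityʳ x))

⊕-cancelˡ : ∀ {n} (x b : BVec n) → x ⊕ (x ⊕ b) ≡ b
⊕-cancelˡ x b = trans (sym (⊕-assoc x x b)) (trans (cong (_⊕ b) (⊕-self x)) (⊕-identityˡ b))

⊕-left-comm : ∀ {n} (a b c : BVec n) → a ⊕ (b ⊕ c) ≡ b ⊕ (a ⊕ c)
⊕-left-comm a b c = trans (sym (⊕-assoc a b c)) (trans (cong (_⊕ c) (⊕-comm a b)) (⊕-assoc b a c))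

⊕-cancel-common : ∀ {n} (c a b : BVec n) → (c ⊕ a) ⊕ (c ⊕ b) ≡ a ⊕ b
⊕-cancel-common c a b =
  trans (⊕-assoc c a (c ⊕ b)) (trans (cong (c ⊕_) (⊕-left-comm a c b)) (⊕-cancelˡ c (a ⊕ b)))

⊕-swap : ∀ {n} (x a b : BVec n) → (x ⊕ a) ⊕ b ≡ (x ⊕ b) ⊕ a
⊕-swap x a b = trans (⊕-assoc x a b) (trans (cong (x ⊕_) (⊕-comm a b)) (sym (⊕-assoc x b a)))

ind : Bool → ℕ
ind b = if b then 1 else 0

∑ : (n : ℕ) → (BVec n → ℕ) → ℕ
∑ zero f = f []
∑ (suc n) f = ∑ n (λ x → f (false ∷ x)) + ∑ n (λ x → f (true ∷ x))

sum-allVecs : ∀ n (f : BVec n → ℕ) → sum (map f (allVecs n)) ≡ ∑ n f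
sum-allVecs zero f = +-identityʳ (f [])
sum-allVecs (suc n) f = begin
  sum (map f (map (false ∷_) L ++ map (true ∷_) L))
    ≡⟨ cong sum (map-++ f (map (false ∷_) L) (map (true ∷_) L)) ⟩
  sum (map f (map (false ∷_) L) ++ map f (map (true ∷_) L))
    ≡⟨ sum-++ (map f (map (false ∷_) L)) _ ⟩
  sum (map f (map (false ∷_) L)) + sum (map f (map (true ∷_) L))
    ≡⟨ cong₂ _+_ (cong sum (sym (map-∘ L))) (cong sum (sym (map-∘ L))) ⟩
  sum (map (λ x → f (false ∷ x)) L) + sum (map (λ x → f (true ∷ x)) L)
    ≡⟨ cong₂ _+_ (sum-allVecs n _) (sum-allVecs n _) ⟩
  ∑ (suc n) f ∎
  where
  open ≡-Reasoning
  L = allVecs n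

∑-cong : ∀ n {f g : BVec n → ℕ} → (∀ x → f x ≡ g x) → ∑ n f ≡ ∑ n g
∑-cong zero eq = eq []
∑-cong (suc n) eq = cong₂ _+_ (∑-cong n (λ x → eq (false ∷ x))) (∑-cong n (λ x → eq (true ∷ x)))

∑-mono : ∀ n {f g : BVec n → ℕ} → (∀ x → f x ≤ g x) → ∑ n f ≤ ∑ n g
∑-mono zero le = le []
∑-mono (suc n) le = +-mono-≤ (∑-mono n (λ x → le (false ∷ x))) (∑-mono n (λ x → le (true ∷ x)))

∑-+ : ∀ n (f g : BVec n → ℕ) → ∑ n (λ x → f x + g x) ≡ ∑ n f + ∑ n g
∑-+ zero f g = refl
∑-+ (suc n) f g = trans
  (cong₂ _+_ (∑-+ n (λ x → f (false ∷ x)) (λ x → g (false ∷ x)))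
             (∑-+ n (λ x → f (true ∷ x)) (λ x → g (true ∷ x))))
  (interchange (∑ n (λ x → f (false ∷ x))) (∑ n (λ x → g (false ∷ x)))
               (∑ n (λ x → f (true ∷ x))) (∑ n (λ x → g (true ∷ x))))

∑-zero : ∀ n (f : BVec n → ℕ) → (∀ x → f x ≡ 0) → ∑ n f ≡ 0
∑-zero zero f eq = eq []
∑-zero (suc n) f eq = cong₂ _+_ (∑-zero n _ (λ x → eq (false ∷ x))) (∑-zero n _ (λ x → eq (true ∷ x)))

term≤∑ : ∀ n (f : BVec n → ℕ) x → f x ≤ ∑ n f
term≤∑ zero f [] = ≤-refl
term≤∑ (suc n) f (false ∷ x) = ≤-trans (term≤∑ n _ x) (m≤m+n _ _)
term≤∑ (suc n) f (true ∷ x) = ≤-trans (term≤∑ n _ x) (m≤n+m _ _)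

-- Translation x ↦ x ⊕ b permutes {0,1}^n, so it leaves sums unchanged.
∑-translate : ∀ n (f : BVec n → ℕ) b → ∑ n (λ x → f (x ⊕ b)) ≡ ∑ n f
∑-translate zero f [] = refl
∑-translate (suc n) f (false ∷ b) = cong₂ _+_ (∑-translate n _ b) (∑-translate n _ b)
∑-translate (suc n) f (true ∷ b) =
  trans (cong₂ _+_ (∑-translate n (λ x → f (true ∷ x)) b) (∑-translate n (λ x → f (false ∷ x)) b))
        (+-comm (∑ n (λ x → f (true ∷ x))) (∑ n (λ x → f (false ∷ x))))

count : ∀ {n} → Subset n → ℕ
count {n} X = ∑ n (λ x → ind (X x))

card≡count : ∀ {n} (A : Subset n) → card A ≡ count A
card≡count {n} A = sum-allVecs n (λ x → ind (A x))

count-cong : ∀ {n} {X Y : Subset n} → (∀ x → X x ≡ Y x) → count X ≡ count Y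
count-cong {n} eq = ∑-cong n (λ x → cong ind (eq x))

count-empty : ∀ {n} (X : Subset n) → (∀ x → X x ≡ false) → count X ≡ 0
count-empty {n} X empty = ∑-zero n _ (λ x → cong ind (empty x))

count-translate : ∀ {n} (X : Subset n) b → count (translate X b) ≡ count X
count-translate {n} X = ∑-translate n (λ x → ind (X x))

_∩_ : ∀ {n} → Subset n → Subset n → Subset n
(X ∩ A) x = X x ∧ A x

count-∩-∖ : ∀ {n} (X A : Subset n) → count (X ∩ A) + count (X ∖ A) ≡ count X
count-∩-∖ {n} X A = trans (sym (∑-+ n _ _)) (∑-cong n (λ x → split (X x) (A x)))
  where
  split : ∀ t a → ind (t ∧ a) + ind (t ∧ not a) ≡ ind t
  split true true = refl
  split true false = refl
  split false a = refl

record _≐_⊔_ {n} (T P Q : Subset n) : Set where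
  field
    cover : ∀ x → T x ≡ P x ∨ Q x
    disjoint : ∀ x → P x ∧ Q x ≡ false
open _≐_⊔_

ind-∨ : ∀ p q → p ∧ q ≡ false → ∀ k → ind ((p ∨ q) ∧ k) ≡ ind (p ∧ k) + ind (q ∧ k)
ind-∨ true false _ k = sym (+-identityʳ (ind k))
ind-∨ false q _ k = refl

ind-∨-mid : ∀ p q → p ∧ q ≡ false → ∀ a k → ind (a ∧ (p ∨ q) ∧ k) ≡ ind (a ∧ p ∧ k) + ind (a ∧ q ∧ k)
ind-∨-mid p q pq true k = ind-∨ p q pq k
ind-∨-mid p q pq false k = refl

count-split : ∀ {n} {T P Q : Subset n} → T ≐ P ⊔ Q → ∀ (R : Subset n) →
  count (λ x → T x ∧ R x) ≡ count (λ x → P x ∧ R x) + count (λ x → Q x ∧ R x)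
count-split {n} {T} {P} {Q} part R = trans
  (∑-cong n (λ x → trans (cong (λ t → ind (t ∧ R x)) (cover part x)) (ind-∨ (P x) (Q x) (disjoint part x) (R x))))
  (∑-+ n _ _)

Shifted : ∀ {n} → BVec n → Subset n → Subset n → Set
Shifted b X Y = ∀ x → Y (x ⊕ b) ≡ X x

shifted-translate : ∀ {n} b (X : Subset n) → Shifted b X (translate X b)
shifted-translate b X x = cong X (⊕-cancel x b)

shifted-back : ∀ {n} b (Y : Subset n) → Shifted b (translate Y b) Y
shifted-back b Y x = refl

leaving : ∀ {n} → Subset n → Subset n → BVec n → ℕ
leaving X A b = count (λ x → (X ∩ A) x ∧ not (A (x ⊕ b)))

count-shift : ∀ {n} b {X Y : Subset n} → Shifted b X Y → ∀ A →
  count (X ∩ A) ≤ count (Y ∩ A) + leaving X A b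
count-shift {n} b {X} {Y} sh A = begin
  count (X ∩ A)                                            ≤⟨ ∑-mono n (λ x → bound (X x) (A x) (A (x ⊕ b))) ⟩
  ∑ n (λ x → ind (X x ∧ A (x ⊕ b)) + ind ((X ∩ A) x ∧ not (A (x ⊕ b))))
                                                           ≡⟨ ∑-+ n _ _ ⟩
  count (λ x → X x ∧ A (x ⊕ b)) + leaving X A b            ≡⟨ cong (_+ leaving X A b) moved ⟩
  count (Y ∩ A) + leaving X A b                            ∎
  where
  open ≤-Reasoning
  bound : ∀ t a a' → ind (t ∧ a) ≤ ind (t ∧ a') + ind ((t ∧ a) ∧ not a')
  bound true true true = s≤s z≤n
  bound true true false = s≤s z≤n
  bound true false a' = z≤n
  bound false a a' = z≤n
  moved : count (λ x → X x ∧ A (x ⊕ b)) ≡ count (Y ∩ A)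
  moved = trans (count-cong (λ x → cong (_∧ A (x ⊕ b)) (sym (sh x)))) (count-translate (Y ∩ A) b)

∑² : (n : ℕ) → (BVec n → BVec n → ℕ) → ℕ
∑² n F = ∑ n (λ x → ∑ n (λ y → F x y))

∑²-cong : ∀ n {F G : BVec n → BVec n → ℕ} → (∀ x y → F x y ≡ G x y) → ∑² n F ≡ ∑² n G
∑²-cong n eq = ∑-cong n (λ x → ∑-cong n (eq x))

∑²-+ : ∀ n (F G : BVec n → BVec n → ℕ) → ∑² n (λ x y → F x y + G x y) ≡ ∑² n F + ∑² n G
∑²-+ n F G = trans (∑-cong n (λ x → ∑-+ n (F x) (G x))) (∑-+ n _ _)

pairs : ∀ {n} → ℕ → Subset n → Subset n → ℕ
pairs {n} s X Y = ∑² n (λ x y → ind (X x ∧ Y y ∧ (dist x y ≤ᵇ s)))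

sum-concatMap : ∀ {A : Set} (g : A → List ℕ) (L : List A) →
  sum (concatMap g L) ≡ sum (map (λ x → sum (g x)) L)
sum-concatMap g [] = refl
sum-concatMap g (x ∷ L) = trans (sum-++ (g x) (concatMap g L)) (cong (sum (g x) +_) (sum-concatMap g L))

cut≡pairs : ∀ {n} (S : Subset n) s A → cut S s A ≡ pairs s A (S ∖ A)
cut≡pairs {n} S s A = begin
  cut S s A                                      ≡⟨ sum-concatMap (λ x → map (F x) (allVecs n)) (allVecs n) ⟩
  sum (map (λ x → sum (map (F x) (allVecs n))) (allVecs n))
                                                 ≡⟨ sum-allVecs n _ ⟩
  ∑ n (λ x → sum (map (F x) (allVecs n)))        ≡⟨ ∑-cong n (λ x → sum-allVecs n (F x)) ⟩
  pairs s A (S ∖ A)                              ∎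
  where
  open ≡-Reasoning
  F : BVec n → BVec n → ℕ
  F x y = ind (A x ∧ (S ∖ A) y ∧ (dist x y ≤ᵇ s))

pairs-congˡ : ∀ {n} s {X X' : Subset n} (Y : Subset n) → (∀ x → X x ≡ X' x) → pairs s X Y ≡ pairs s X' Y
pairs-congˡ {n} s Y eq = ∑²-cong n (λ x y → cong (λ v → ind (v ∧ _)) (eq x))

pairs-splitˡ : ∀ {n} s {T P Q : Subset n} → T ≐ P ⊔ Q → ∀ (R Y : Subset n) →
  pairs s (λ x → T x ∧ R x) Y ≡ pairs s (λ x → P x ∧ R x) Y + pairs s (λ x → Q x ∧ R x) Y
pairs-splitˡ {n} s {T} {P} {Q} part R Y = trans (∑²-cong n summand) (∑²-+ n _ _)
  where
  summand : ∀ x y → let w = Y y ∧ (dist x y ≤ᵇ s) in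
    ind ((T x ∧ R x) ∧ w) ≡ ind ((P x ∧ R x) ∧ w) + ind ((Q x ∧ R x) ∧ w)
  summand x y = begin
    ind ((T x ∧ R x) ∧ w)                        ≡⟨ cong ind (∧-assoc (T x) (R x) w) ⟩
    ind (T x ∧ R x ∧ w)                          ≡⟨ cong (λ t → ind (t ∧ R x ∧ w)) (cover part x) ⟩
    ind ((P x ∨ Q x) ∧ R x ∧ w)                  ≡⟨ ind-∨ (P x) (Q x) (disjoint part x) (R x ∧ w) ⟩
    ind (P x ∧ R x ∧ w) + ind (Q x ∧ R x ∧ w)    ≡⟨ sym (cong₂ _+_ (cong ind (∧-assoc (P x) (R x) w))
                                                                  (cong ind (∧-assoc (Q x) (R x) w))) ⟩
    ind ((P x ∧ R x) ∧ w) + ind ((Q x ∧ R x) ∧ w) ∎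
    where
    open ≡-Reasoning
    w = Y y ∧ (dist x y ≤ᵇ s)

pairs-splitʳ : ∀ {n} s {T P Q : Subset n} → T ≐ P ⊔ Q → ∀ (X R : Subset n) →
  pairs s X (λ y → T y ∧ R y) ≡ pairs s X (λ y → P y ∧ R y) + pairs s X (λ y → Q y ∧ R y)
pairs-splitʳ {n} s {T} {P} {Q} part X R = trans (∑²-cong n summand) (∑²-+ n _ _)
  where
  summand : ∀ x y → let d = dist x y ≤ᵇ s in
    ind (X x ∧ (T y ∧ R y) ∧ d) ≡ ind (X x ∧ (P y ∧ R y) ∧ d) + ind (X x ∧ (Q y ∧ R y) ∧ d)
  summand x y = begin
    ind (X x ∧ (T y ∧ R y) ∧ d)                  ≡⟨ cong (λ v → ind (X x ∧ v)) (∧-assoc (T y) (R y) d) ⟩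
    ind (X x ∧ T y ∧ R y ∧ d)                    ≡⟨ cong (λ t → ind (X x ∧ t ∧ R y ∧ d)) (cover part y) ⟩
    ind (X x ∧ (P y ∨ Q y) ∧ R y ∧ d)            ≡⟨ ind-∨-mid (P y) (Q y) (disjoint part y) (X x) (R y ∧ d) ⟩
    ind (X x ∧ P y ∧ R y ∧ d) + ind (X x ∧ Q y ∧ R y ∧ d)
                                                 ≡⟨ sym (cong₂ _+_ (cong (λ v → ind (X x ∧ v)) (∧-assoc (P y) (R y) d))
                                                                   (cong (λ v → ind (X x ∧ v)) (∧-assoc (Q y) (R y) d))) ⟩
    ind (X x ∧ (P y ∧ R y) ∧ d) + ind (X x ∧ (Q y ∧ R y) ∧ d) ∎
    where
    open ≡-Reasoning
    d = dist x y ≤ᵇ s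

-- If weight b ≤ s then x and x ⊕ b are close, so every x ∈ X with x ⊕ b ∈ Y
-- contributes the pair (x, x ⊕ b).
pairs-matching : ∀ {n} s b → weight b ≤ s → ∀ (X Y : Subset n) →
  count (λ x → X x ∧ Y (x ⊕ b)) ≤ pairs s X Y
pairs-matching {n} s b w X Y = ∑-mono n (λ x →
  subst (_≤ ∑ n (λ y → ind (X x ∧ Y y ∧ (dist x y ≤ᵇ s)))) (close x)
        (term≤∑ n (λ y → ind (X x ∧ Y y ∧ (dist x y ≤ᵇ s))) (x ⊕ b)))
  where
  close : ∀ x → ind (X x ∧ Y (x ⊕ b) ∧ (dist x (x ⊕ b) ≤ᵇ s)) ≡ ind (X x ∧ Y (x ⊕ b))
  close x = begin
    ind (X x ∧ Y (x ⊕ b) ∧ (dist x (x ⊕ b) ≤ᵇ s)) ≡⟨ cong (λ v → ind (X x ∧ Y (x ⊕ b) ∧ (weight v ≤ᵇ s))) (⊕-cancelˡ x b) ⟩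
    ind (X x ∧ Y (x ⊕ b) ∧ (weight b ≤ᵇ s))       ≡⟨ cong (λ v → ind (X x ∧ Y (x ⊕ b) ∧ v)) (Equivalence.to T-≡ (≤⇒≤ᵇ w)) ⟩
    ind (X x ∧ Y (x ⊕ b) ∧ true)                  ≡⟨ cong (λ v → ind (X x ∧ v)) (∧-identityʳ (Y (x ⊕ b))) ⟩
    ind (X x ∧ Y (x ⊕ b))                         ∎
    where open ≡-Reasoning

leaving≤pairs : ∀ {n} s b → weight b ≤ s → ∀ {X Y : Subset n} → Shifted b X Y → ∀ A →
  leaving X A b ≤ pairs s (X ∩ A) (Y ∖ A)
leaving≤pairs s b w {X} {Y} sh A =
  subst (_≤ pairs s (X ∩ A) (Y ∖ A)) (count-cong (λ x → redundant (sh x)))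
        (pairs-matching s b w (X ∩ A) (Y ∖ A))
  where
  redundant : ∀ {x} → Y (x ⊕ b) ≡ X x →
    (X ∩ A) x ∧ (Y ∖ A) (x ⊕ b) ≡ (X ∩ A) x ∧ not (A (x ⊕ b))
  redundant {x} eq rewrite eq with X x
  ... | true = refl
  ... | false = refl

-- Arithmetic behind the inductive step of the isoperimetric inequality.

⊓≤half : ∀ x y N → x + y ≡ N + N → x ⊓ y ≤ N
⊓≤half x y N eq with ≤-total x N
... | inj₁ x≤N = ≤-trans (m⊓n≤m x y) x≤N
... | inj₂ N≤x = ≤-trans (m⊓n≤n x y) (+-cancelˡ-≤ N y N (≤-trans (+-monoˡ-≤ y N≤x) (≤-reflexive eq)))

union-⊓≤N : ∀ a₀ a₁ c₀ c₁ {N} → a₀ + c₀ ≡ N → a₁ + c₁ ≡ N → (a₀ + a₁) ⊓ (c₀ + c₁) ≤ N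
union-⊓≤N a₀ a₁ c₀ c₁ {N} size₀ size₁ =
  ⊓≤half (a₀ + a₁) (c₀ + c₁) N (trans (interchange a₀ a₁ c₀ c₁) (cong₂ _+_ size₀ size₁))

⊓-step : ∀ {a₀ a₁ c₀ c₁ e₀ e₁ N} → a₀ + c₀ ≡ N → a₁ + c₁ ≡ N → a₀ ≤ a₁ + e₀ → a₁ ≤ a₀ + e₁ →
  (a₀ + a₁) ⊓ (c₀ + c₁) ≤ (a₀ ⊓ c₀ + a₁ ⊓ c₁) + (e₀ + e₁)
⊓-step {a₀} {a₁} {c₀} {c₁} {e₀} {e₁} {N} size₀ size₁ shift₀ shift₁
  with ≤-total a₀ c₀ | ≤-total a₁ c₁
... | inj₁ p | inj₁ q rewrite m≤n⇒m⊓n≡m p | m≤n⇒m⊓n≡m q = ≤-trans (m⊓n≤m _ _) (m≤m+n _ _)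
... | inj₂ p | inj₂ q rewrite m≥n⇒m⊓n≡n p | m≥n⇒m⊓n≡n q = ≤-trans (m⊓n≤n _ _) (m≤m+n _ _)
... | inj₁ p | inj₂ q rewrite m≤n⇒m⊓n≡m p | m≥n⇒m⊓n≡n q = begin
  (a₀ + a₁) ⊓ (c₀ + c₁)  ≤⟨ union-⊓≤N a₀ a₁ c₀ c₁ size₀ size₁ ⟩
  N                      ≡⟨ sym size₁ ⟩
  a₁ + c₁                ≤⟨ +-monoˡ-≤ c₁ shift₁ ⟩
  (a₀ + e₁) + c₁         ≡⟨ xy∙z≈xz∙y a₀ e₁ c₁ ⟩
  (a₀ + c₁) + e₁         ≤⟨ +-monoʳ-≤ (a₀ + c₁) (m≤n+m e₁ e₀) ⟩
  (a₀ + c₁) + (e₀ + e₁)  ∎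
  where open ≤-Reasoning
... | inj₂ p | inj₁ q rewrite m≥n⇒m⊓n≡n p | m≤n⇒m⊓n≡m q = begin
  (a₀ + a₁) ⊓ (c₀ + c₁)  ≤⟨ union-⊓≤N a₀ a₁ c₀ c₁ size₀ size₁ ⟩
  N                      ≡⟨ sym size₀ ⟩
  a₀ + c₀                ≤⟨ +-monoˡ-≤ c₀ shift₀ ⟩
  (a₁ + e₀) + c₀         ≡⟨ xy∙z≈zx∙y a₁ e₀ c₀ ⟩
  (c₀ + a₁) + e₀         ≤⟨ +-monoʳ-≤ (c₀ + a₁) (m≤m+n e₀ e₁) ⟩
  (c₀ + a₁) + (e₀ + e₁)  ∎
  where open ≤-Reasoning

-- s-cubes: images of {0,1}^d in which each coordinate direction moves by a
-- vector of weight ≤ s.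
data Cube {n : ℕ} (s : ℕ) : ℕ → Subset n → Set where
  point  : ∀ {T : Subset n} p → (∀ x → x ∈ T → x ≡ p) → Cube s 0 T
  double : ∀ {d} {T T' : Subset n} b → weight b ≤ s → Cube s d T' → T ≐ T' ⊔ translate T' b →
           Cube s (suc d) T

cube-cong : ∀ {n s d} {T U : Subset n} → (∀ x → U x ≡ T x) → Cube s d T → Cube s d U
cube-cong eq (point p single) = point p (λ x x∈U → single x (trans (sym (eq x)) x∈U))
cube-cong eq (double b w c part) =
  double b w c (record { cover = λ x → trans (eq x) (cover part x) ; disjoint = disjoint part })

⊔-translate : ∀ {n} {T P : Subset n} {b} → T ≐ P ⊔ translate P b → ∀ v →
  translate T v ≐ translate P v ⊔ translate (translate P v) b
⊔-translate {P = P} {b} part v = record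
  { cover = λ x → trans (cover part (x ⊕ v)) (cong (λ u → P (x ⊕ v) ∨ P u) (⊕-swap x v b))
  ; disjoint = λ x → trans (cong (λ u → P (x ⊕ v) ∧ P u) (⊕-swap x b v)) (disjoint part (x ⊕ v))
  }

cube-translate : ∀ {n s d} {T : Subset n} → Cube s d T → ∀ v → Cube s d (translate T v)
cube-translate (point p single) v =
  point (p ⊕ v) (λ x x∈T → trans (sym (⊕-cancel x v)) (cong (_⊕ v) (single (x ⊕ v) x∈T)))
cube-translate (double b w c part) v = double b w (cube-translate c v) (⊔-translate part v)

point-empty : ∀ {n} {T : Subset n} {p} → (∀ x → x ∈ T → x ≡ p) → ∀ (R : Subset n) → R p ≡ false →
  ∀ x → T x ∧ R x ≡ false
point-empty {T = T} single R Rp x with T x in x∈T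
... | false = refl
... | true = trans (cong R (single x x∈T)) Rp

-- Induction
-- on the dimension: split T = T' ⊔ (T' + b), apply the hypothesis to both halves,
-- and pay for the difference of the two halves of A with the pairs (x, x ⊕ b).
isoperimetry : ∀ {n s d} {T : Subset n} → Cube s d T → ∀ A →
  count (T ∩ A) ⊓ count (T ∖ A) ≤ pairs s (T ∩ A) (T ∖ A)
isoperimetry {T = T} (point p single) A with A p in Ap
... | true = ≤-trans (m⊓n≤n _ _)
  (≤-trans (≤-reflexive (count-empty (T ∖ A) (point-empty single (λ x → not (A x)) (cong not Ap)))) z≤n)
... | false = ≤-trans (m⊓n≤m _ _)
  (≤-trans (≤-reflexive (count-empty (T ∩ A) (point-empty single A Ap))) z≤n)
isoperimetry {s = s} {T = T} (double {T' = T'} b w c part) A = begin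
  count (T ∩ A) ⊓ count (T ∖ A)    ≡⟨ cong₂ _⊓_ (count-split part A) (count-split part (λ x → not (A x))) ⟩
  (a₀ + a₁) ⊓ (c₀ + c₁)            ≤⟨ ⊓-step size₀ size₁ shift₀ shift₁ ⟩
  (a₀ ⊓ c₀ + a₁ ⊓ c₁) + (e₀ + e₁)  ≤⟨ +-mono-≤ (+-mono-≤ (isoperimetry c A) (isoperimetry (cube-translate c b) A))
                                              (+-mono-≤ cross₀ cross₁) ⟩
  (p₀₀ + p₁₁) + (p₀₁ + p₁₀)        ≡⟨ interchange p₀₀ p₁₁ p₀₁ p₁₀ ⟩
  (p₀₀ + p₀₁) + (p₁₁ + p₁₀)        ≡⟨ cong ((p₀₀ + p₀₁) +_) (+-comm p₁₁ p₁₀) ⟩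
  (p₀₀ + p₀₁) + (p₁₀ + p₁₁)        ≡⟨ sym edges ⟩
  pairs s (T ∩ A) (T ∖ A)          ∎
  where
  open ≤-Reasoning
  T'' = translate T' b
  a₀ = count (T' ∩ A)
  a₁ = count (T'' ∩ A)
  c₀ = count (T' ∖ A)
  c₁ = count (T'' ∖ A)
  e₀ = leaving T' A b
  e₁ = leaving T'' A b
  p₀₀ = pairs s (T' ∩ A) (T' ∖ A)
  p₀₁ = pairs s (T' ∩ A) (T'' ∖ A)
  p₁₀ = pairs s (T'' ∩ A) (T' ∖ A)
  p₁₁ = pairs s (T'' ∩ A) (T'' ∖ A)
  size₀ : a₀ + c₀ ≡ count T'
  size₀ = count-∩-∖ T' A
  size₁ : a₁ + c₁ ≡ count T'
  size₁ = trans (count-∩-∖ T'' A) (count-translate T' b)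
  shift₀ : a₀ ≤ a₁ + e₀
  shift₀ = count-shift b (shifted-translate b T') A
  shift₁ : a₁ ≤ a₀ + e₁
  shift₁ = count-shift b (shifted-back b T') A
  cross₀ : e₀ ≤ p₀₁
  cross₀ = leaving≤pairs s b w (shifted-translate b T') A
  cross₁ : e₁ ≤ p₁₀
  cross₁ = leaving≤pairs s b w (shifted-back b T') A
  edges : pairs s (T ∩ A) (T ∖ A) ≡ (p₀₀ + p₀₁) + (p₁₀ + p₁₁)
  edges = trans (pairs-splitˡ s part A (T ∖ A))
                (cong₂ _+_ (pairs-splitʳ s part (T' ∩ A) (λ x → not (A x)))
                           (pairs-splitʳ s part (T'' ∩ A) (λ x → not (A x))))

isZero : ∀ {n} → BVec n → Bool
isZero [] = true
isZero (true ∷ _) = false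
isZero (false ∷ x) = isZero x

isZero-sound : ∀ {n} (x : BVec n) → isZero x ≡ true → x ≡ 0ᵥ
isZero-sound [] _ = refl
isZero-sound (false ∷ x) eq = cong (false ∷_) (isZero-sound x eq)

isZero-0ᵥ : ∀ n → isZero (0ᵥ {n}) ≡ true
isZero-0ᵥ zero = refl
isZero-0ᵥ (suc n) = isZero-0ᵥ n

Span : ∀ {n k} → Vec (BVec n) k → Subset n
Span [] = isZero
Span (b ∷ bs) x = Span bs x ∨ Span bs (x ⊕ b)

span-sound : ∀ {n k} (bs : Vec (BVec n) k) y → y ∈ Span bs → Σ (Vec Bool k) λ c → combo bs c ≡ y
span-sound [] y y∈span = [] , sym (isZero-sound y y∈span)
span-sound (b ∷ bs) y y∈span with Span bs y in y∈tail
... | true = let (c , eq) = span-sound bs y y∈tail in false ∷ c , eq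
... | false = let (c , eq) = span-sound bs (y ⊕ b) y∈span in
  true ∷ c , trans (cong (b ⊕_) eq) (trans (⊕-comm b (y ⊕ b)) (⊕-cancel y b))

span-complete : ∀ {n k} (bs : Vec (BVec n) k) c → combo bs c ∈ Span bs
span-complete {n} [] [] = isZero-0ᵥ n
span-complete (b ∷ bs) (false ∷ c) rewrite span-complete bs c = refl
span-complete (b ∷ bs) (true ∷ c) = begin
  Span bs (b ⊕ u) ∨ Span bs ((b ⊕ u) ⊕ b) ≡⟨ cong (λ v → Span bs (b ⊕ u) ∨ Span bs v)
                                                  (trans (⊕-comm (b ⊕ u) b) (⊕-cancelˡ b u)) ⟩
  Span bs (b ⊕ u) ∨ Span bs u             ≡⟨ cong (Span bs (b ⊕ u) ∨_) (span-complete bs c) ⟩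
  Span bs (b ⊕ u) ∨ true                  ≡⟨ ∨-zeroʳ (Span bs (b ⊕ u)) ⟩
  true                                    ∎
  where
  open ≡-Reasoning
  u = combo bs c

combo-⊕ : ∀ {n k} (bs : Vec (BVec n) k) c c' → combo bs (c ⊕ c') ≡ combo bs c ⊕ combo bs c'
combo-⊕ [] [] [] = sym (⊕-identityˡ 0ᵥ)
combo-⊕ (b ∷ bs) (true ∷ c) (true ∷ c') = trans (combo-⊕ bs c c') (sym (⊕-cancel-common b _ _))
combo-⊕ (b ∷ bs) (true ∷ c) (false ∷ c') = trans (cong (b ⊕_) (combo-⊕ bs c c')) (sym (⊕-assoc b _ _))
combo-⊕ (b ∷ bs) (false ∷ c) (true ∷ c') = trans (cong (b ⊕_) (combo-⊕ bs c c')) (⊕-left-comm b _ _)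
combo-⊕ (b ∷ bs) (false ∷ c) (false ∷ c') = combo-⊕ bs c c'

independent-tail : ∀ {n k} {b : BVec n} {bs : Vec (BVec n) k} →
  LinearlyIndependent (b ∷ bs) → LinearlyIndependent bs
independent-tail li c eq = ∷-injectiveʳ (li (false ∷ c) eq)

-- If b ∷ bs is independent then b ∉ span(bs), so span(bs) and span(bs) + b are disjoint.
span-disjoint : ∀ {n k} {b : BVec n} {bs : Vec (BVec n) k} →
  LinearlyIndependent (b ∷ bs) → ∀ u → Span bs u ∧ Span bs (u ⊕ b) ≡ false
span-disjoint {b = b} {bs} li u with Span bs u in u∈span | Span bs (u ⊕ b) in u+b∈span
... | false | _ = refl
... | true | false = refl
... | true | true with span-sound bs u u∈span | span-sound bs (u ⊕ b) u+b∈span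
... | c , eq | c' , eq' with li (true ∷ (c ⊕ c')) b+b≡0
  where
  b+b≡0 : b ⊕ combo bs (c ⊕ c') ≡ 0ᵥ
  b+b≡0 = begin
    b ⊕ combo bs (c ⊕ c')           ≡⟨ cong (b ⊕_) (combo-⊕ bs c c') ⟩
    b ⊕ (combo bs c ⊕ combo bs c')  ≡⟨ cong₂ (λ v v' → b ⊕ (v ⊕ v')) eq eq' ⟩
    b ⊕ (u ⊕ (u ⊕ b))              ≡⟨ cong (b ⊕_) (⊕-cancelˡ u b) ⟩
    b ⊕ b                          ≡⟨ ⊕-self b ⟩
    0ᵥ                             ∎
    where open ≡-Reasoning
... | ()

span-cube : ∀ {n s k} (bs : Vec (BVec n) k) → LinearlyIndependent bs →
  (∀ i → weight (lookup bs i) ≤ s) → Cube s k (Span bs)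
span-cube [] li sparse = point 0ᵥ isZero-sound
span-cube (b ∷ bs) li sparse =
  double b (sparse zero) (span-cube bs (independent-tail li) (λ i → sparse (suc i)))
         (record { cover = λ x → refl ; disjoint = span-disjoint li })

affine-linear-at : ∀ {n} {S : Subset n} → IsAffineSubspace S → ∀ {x₀} → x₀ ∈ S →
  IsLinearSubspace (translate S x₀)
affine-linear-at {S = S} (x₁ , x₁∈S , 0∈L , closed) {x₀} x₀∈S =
  to-S₀ 0ᵥ 0∈L , λ y z y∈S₀ z∈S₀ → to-S₀ (y ⊕ z) (closed y z (to-L y y∈S₀) (to-L z z∈S₀))
  where
  -- S₀ = S - x₀ and L = S - x₁ differ by the translation w = x₀ ⊕ x₁ ∈ L, so they agree.
  w = x₀ ⊕ x₁
  w∈L : w ∈ translate S x₁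
  w∈L = subst (λ v → v ∈ S) (sym (⊕-cancel x₀ x₁)) x₀∈S
  reshift : ∀ y → (y ⊕ w) ⊕ x₁ ≡ y ⊕ x₀
  reshift y = trans (cong (_⊕ x₁) (sym (⊕-assoc y x₀ x₁))) (⊕-cancel (y ⊕ x₀) x₁)
  to-L : ∀ y → y ∈ translate S x₀ → y ∈ translate S x₁
  to-L y y∈S₀ = subst (λ v → v ∈ translate S x₁) (⊕-cancel y w)
    (closed (y ⊕ w) w (subst (λ v → v ∈ S) (sym (reshift y)) y∈S₀) w∈L)
  to-S₀ : ∀ y → y ∈ translate S x₁ → y ∈ translate S x₀
  to-S₀ y y∈L = subst (λ v → v ∈ S) (reshift y) (closed y w y∈L w∈L)

combo-closed : ∀ {n k} {L : Subset n} → IsLinearSubspace L → (bs : Vec (BVec n) k) →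
  (∀ i → lookup bs i ∈ L) → ∀ c → combo bs c ∈ L
combo-closed (0∈L , closed) [] _ [] = 0∈L
combo-closed lin (b ∷ bs) inL (false ∷ c) = combo-closed lin bs (λ i → inL (suc i)) c
combo-closed lin@(_ , closed) (b ∷ bs) inL (true ∷ c) =
  closed b (combo bs c) (inL zero) (combo-closed lin bs (λ i → inL (suc i)) c)

-- An affine subspace with an s-sparse basis is an s-cube: it is the translate
-- x₀ + span(bs) of the span of its basis.
sparse-basis-cube : ∀ {n s} {S : Subset n} → IsAffineSubspace S → AdmitsSparseBasis S s →
  Σ ℕ λ d → Cube s d S
sparse-basis-cube {S = S} affine (x₀ , x₀∈S , D , bs , inL , sparse , li , spanning) =
  D , cube-cong coset (cube-translate (span-cube bs li sparse) x₀)
  where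
  coset : ∀ x → S x ≡ Span bs (x ⊕ x₀)
  coset x = ⇔→≡ (mk⇔ to from)
    where
    to : x ∈ S → Span bs (x ⊕ x₀) ≡ true
    to x∈S = let (c , eq) = spanning (x ⊕ x₀) (subst (λ v → v ∈ S) (sym (⊕-cancel x x₀)) x∈S) in
      subst (λ v → v ∈ Span bs) eq (span-complete bs c)
    from : Span bs (x ⊕ x₀) ≡ true → x ∈ S
    from x∈span = let (c , eq) = span-sound bs (x ⊕ x₀) x∈span in
      subst (λ v → v ∈ S) (trans (cong (_⊕ x₀) eq) (⊕-cancel x x₀))
            (combo-closed (affine-linear-at affine x₀∈S) bs inL c)

∩-⊆ : ∀ {n} {A T : Subset n} → A ⊆ T → ∀ x → (T ∩ A) x ≡ A x
∩-⊆ {A = A} {T} A⊆T x with A x in x∈A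
... | true = trans (∧-identityʳ (T x)) (A⊆T x x∈A)
... | false = ∧-zeroʳ (T x)

cube-cut-bound : ∀ {n s d} {S : Subset n} → Cube s d S → ∀ A → A ⊆ S →
  card A ⊓ card (S ∖ A) ≤ cut S s A
cube-cut-bound {s = s} {S = S} cube A A⊆S = begin
  card A ⊓ card (S ∖ A)                   ≡⟨ cong₂ _⊓_ (trans (card≡count A) (sym (count-cong (∩-⊆ A⊆S))))
                                                      (card≡count (S ∖ A)) ⟩
  count (S ∩ A) ⊓ count (S ∖ A)           ≤⟨ isoperimetry cube A ⟩
  pairs s (S ∩ A) (S ∖ A)                 ≡⟨ pairs-congˡ s (S ∖ A) (∩-⊆ A⊆S) ⟩
  pairs s A (S ∖ A)                       ≡⟨ sym (cut≡pairs S s A) ⟩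
  cut S s A                               ∎
  where open ≤-Reasoning

lemma1p2 : (n : ℕ) (S : Subset n) → IsAffineSubspace S → (s : ℕ) → 0 < s →
             (AdmitsSparseBasis S s → ConductanceAtLeastHalf S s)
             × (ConductanceZero S s → ¬ AdmitsSparseBasis S s)
lemma1p2 n S affine s _ = conductance≥½ , no-basis
  where
  conductance≥½ : AdmitsSparseBasis S s → ConductanceAtLeastHalf S s
  conductance≥½ basis A (A⊆S , _ , _) =
    ≤-trans (cube-cut-bound (proj₂ (sparse-basis-cube affine basis)) A A⊆S) (m≤m+n (cut S s A) _)
  -- A zero cut between two nonempty sides violates the bound above.
  no-basis : ConductanceZero S s → ¬ AdmitsSparseBasis S s
  no-basis (A , admissible@(_ , |A|>0 , |S∖A|>0) , cut≡0) basis =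
    <⇒≱ (⊓-glb |A|>0 |S∖A|>0) (subst (λ c → card A ⊓ card (S ∖ A) ≤ 2 * c) cut≡0 (conductance≥½ basis A admissible))
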